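{- Let $b$ and $n$ be positive integers. If $G$ is a graph on $n$ vertices with minimum degree $\delta(G)>\log_{b+1}(n)-1$, then Dominator wins the $b$-biased Maker-Breaker domination game on $G$ when she is the first player. Moreover, for infinitely many $n$ there is a graph $G$ on $n$ vertices with $\delta(G)>\log_{b+1}(n)-2$ such that Staller wins the $b$-biased Maker-Breaker domination game on $G$ when Dominator is the first player.
   Context: The $b$-biased Maker-Breaker domination game on a finite graph $G$: Dominator and Staller alternately claim previously unclaimed vertices of $G$; in each of her turns Dominator claims up to $b$ vertices, in each of his turns Staller claims one vertex. Dominator wins if the set of vertices she claims contains a dominating set of $G$ (a set $D$ such that every vertex outside $D$ has a neighbour in $D$); otherwise Staller wins. -}

module Defs where

open import Data.Nat using (ℕ; zero; suc; _+_; _≤_; _<_; _^_)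
open import Data.Fin using (Fin; zero; suc)
open import Data.Fin.Subset using (Subset; _∈_; ∣_∣; Nonempty)
open import Data.Bool using (Bool; true; false; if_then_else_)
open import Data.Vec using (lookup)
open import Data.Product using (Σ; ∃; _×_; _,_)
open import Data.Sum using (_⊎_)
open import Relation.Binary.PropositionalEquality using (_≡_)
open import Relation.Nullary using (¬_; yes; no)
open import Data.Fin using (_≟_)

record Graph (n : ℕ) : Set where
  field
    adj   : Fin n → Fin n → Bool
    sym   : ∀ u v → adj u v ≡ adj v u
    irrefl : ∀ v → adj v v ≡ false
open Graph public

countTrue : ∀ {n} → (Fin n → Bool) → ℕ
countTrue {zero} f = 0
countTrue {suc n} f = (if f zero then 1 else 0) + countTrue (λ i → f (suc i))

degree : ∀ {n} → Graph n → Fin n → ℕ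
degree G v = countTrue (adj G v)

data Owner : Set where
  free dom stal : Owner

Position : ℕ → Set
Position n = Fin n → Owner

IsDominating : ∀ {n} → Graph n → Subset n → Set
IsDominating {n} G D = ∀ v → v ∈ D ⊎ (∃ λ u → adj G v u ≡ true × u ∈ D)

-- the set of vertices claimed by Dominator contains a dominating set;
-- since supersets of dominating sets are dominating, this is equivalent
-- to the claimed set itself being dominating; we state it literally.
DomHasDominating : ∀ {n} → Graph n → Position n → Set
DomHasDominating {n} G p =
  Σ (Subset n) λ D → (∀ v → v ∈ D → p v ≡ dom) × IsDominating G D

LegalDomMove : ∀ {n} → ℕ → Position n → Subset n → Set
LegalDomMove b p S = Nonempty S × ∣ S ∣ ≤ b × (∀ v → v ∈ S → p v ≡ free)

claimSet : ∀ {n} → Position n → Subset n → Position n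
claimSet p S v = if lookup S v then dom else p v

claimVertex : ∀ {n} → Position n → Fin n → Position n
claimVertex {n} p v w with v ≟ w
... | yes _ = stal
... | no _ = p w

HasFree : ∀ {n} → Position n → Set
HasFree p = ∃ λ v → p v ≡ free

-- Dominator (playing with bias b) can force a win from position p,
-- with Dominator / Staller to move respectively.
mutual
  data DomWinsD {n} (G : Graph n) (b : ℕ) : Position n → Set where
    done : ∀ {p} → DomHasDominating G p → DomWinsD G b p
    move : ∀ {p} (S : Subset n) → LegalDomMove b p S →
           DomWinsS G b (claimSet p S) → DomWinsD G b p

  data DomWinsS {n} (G : Graph n) (b : ℕ) : Position n → Set where
    done : ∀ {p} → DomHasDominating G p → DomWinsS G b p
    reply : ∀ {p} → HasFree p →
            (∀ v → p v ≡ free → DomWinsD G b (claimVertex p v)) →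
            DomWinsS G b p

-- Staller can force a win from position p (Dominator / Staller to move).
-- The game ends when no unclaimed vertex is left for the player to move.
mutual
  data StWinsD {n} (G : Graph n) (b : ℕ) : Position n → Set where
    step : ∀ {p} → ¬ DomHasDominating G p →
           (∀ S → LegalDomMove b p S → StWinsS G b (claimSet p S)) →
           StWinsD G b p

  data StWinsS {n} (G : Graph n) (b : ℕ) : Position n → Set where
    over : ∀ {p} → ¬ DomHasDominating G p → ¬ HasFree p → StWinsS G b p
    step : ∀ {p} → ¬ DomHasDominating G p → (v : Fin n) → p v ≡ free →
           StWinsD G b (claimVertex p v) → StWinsS G b p

start : ∀ {n} → Position n
start _ = free

DominatorWins : ∀ {n} → Graph n → ℕ → Set
DominatorWins G b = DomWinsD G b start

StallerWins : ∀ {n} → Graph n → ℕ → Set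
StallerWins G b = StWinsD G b start

-- δ(G) > log_{b+1}(n) - k  ⇔  ∀ v, deg v + k > log_{b+1} n  ⇔  n < (b+1)^(deg v + k)
MinDegAboveLogMinus : ∀ {n} → Graph n → ℕ → ℕ → Set
MinDegAboveLogMinus {n} G b k = ∀ v → n < suc b ^ (degree G v + k)

-- Dominator's half is an Erdős–Selfridge argument on the hypergraph of closed neighbourhoods. Give
-- N[v] the weight (b+1)^s while it holds no Dominator vertex and s Staller vertices, and 0 afterwards;
-- the total weight Φ starts at n. Staller claiming x raises Φ by b times the danger of x (the weight
-- of the neighbourhoods through x), while Dominator, claiming b vertices of largest danger one after
-- another, first lowers Φ by at least as much; so Φ ≤ n throughout. A neighbourhood entirely claimed
-- by Staller would weigh (b+1)^(δ+1) > n, so when the board is full Dominator's vertices dominate.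
--
-- For Staller's half take the words of length 1, …, k+1 over b+1 letters, adjacent when one is a
-- proper prefix of the other: fewer than (b+1)^(k+2) vertices, minimum degree k. Staller descends the
-- tree, each time claiming a child of his last vertex whose subtree Dominator has not touched (her b
-- claims cannot meet all b+1 subtrees). No leaf below him can then be dominated, and once he claims a
-- leaf he owns its whole closed neighbourhood.

module Submission where

open import Defs renaming (sym to adj-sym)
open import Data.Nat using (ℕ; zero; suc; _+_; _*_; _∸_; _≤_; _<_; _^_; _⊓_; z≤n; s≤s; s≤s⁻¹; _≤?_; _<?_)
open import Data.Nat.Properties hiding (_≟_)
open import Data.Fin using (Fin; zero; suc; _≟_; toℕ; splitAt; _↑ˡ_; _↑ʳ_; remQuot; combine)
import Data.Fin.Properties as Finₚ
open Finₚ
  using (any?; toℕ<n; toℕ-injective; splitAt-↑ˡ; splitAt-↑ʳ; splitAt⁻¹-↑ˡ; splitAt⁻¹-↑ʳ; remQuot-combine; combine-remQuot)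
open import Data.Fin.Subset using (Subset; _∈_; _∉_; ∣_∣; Nonempty; ⊥; ⁅_⁆; _∪_; _-_)
open import Data.Fin.Subset.Properties
  using ( _∈?_; ∉⊥; ∣⊥∣≡0; ∣p∣≤∣x∷p∣; ∪-identityˡ; x∈⁅x⁆; x∈⁅y⁆⇒x≡y; x∈p∪q⁻; x∈p∪q⁺
        ; x∈p⇒∣p-x∣<∣p∣; x∈p∧x≢y⇒x∈p-y)
open import Data.Bool using (Bool; true; false; if_then_else_; _∧_; _∨_)
open import Data.Bool.Properties using (∨-comm; ∨-zeroʳ; ∧-zeroʳ; ∧-identityʳ)
open import Data.Product using (Σ; ∃; _×_; _,_; proj₁; proj₂; uncurry)
import Data.Product as Product
open import Data.Sum using (_⊎_; inj₁; inj₂)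
import Data.Sum as Sum
open import Data.Vec using (_∷_; lookup; tabulate)
open import Data.List using (List; []; _∷_; [_]; length; _++_; _∷ʳ_; take; drop; replicate)
open import Data.List.Properties using (∷-injective; length-++; length-take; length-replicate; take++drop≡id)
open import Data.List.Relation.Binary.Pointwise using (Pointwise-≡⇒≡)
import Data.List.Relation.Binary.Pointwise as Pointwise
open import Data.List.Relation.Binary.Prefix.Heterogeneous using (Prefix; []; _∷_; _++ᵖ_)
open import Data.List.Relation.Binary.Prefix.Heterogeneous.Properties
  using (fromPointwise; toPointwise; length-mono; prefix?)
import Data.List.Relation.Binary.Prefix.Heterogeneous.Properties as Prefixₚ
open import Data.Vec.Properties using (lookup∘tabulate; lookup⇒[]=; []=⇒lookup)
open import Function using (_∘_)
open import Relation.Binary.PropositionalEquality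
  using (_≡_; _≢_; _≗_; refl; sym; trans; cong; cong₂; subst; module ≡-Reasoning)
open import Relation.Nullary using (¬_; ¬?; yes; no; Dec; does; contradiction; _×-dec_)
open import Relation.Nullary.Decidable using (dec-true; dec-false; does-⇔; decidable-stable)
open import Function.Bundles using (mk⇔)
open import Relation.Unary using (Decidable)
open import Algebra.Properties.CommutativeSemigroup +-commutativeSemigroup using (x∙yz≈y∙xz)
open import Algebra.Properties.Semiring.Sum +-*-semiring using (sum; sum-cong-≗; ∑-distrib-+; *-distribˡ-sum)

private
  variable
    m n : ℕ

∨-true⁻ : ∀ x y → x ∨ y ≡ true → x ≡ true ⊎ y ≡ true
∨-true⁻ true  _ _ = inj₁ refl
∨-true⁻ false _ h = inj₂ h

does-true⁻ : {P : Set} (P? : Dec P) → does P? ≡ true → P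
does-true⁻ (yes p) _ = p

-- Counting on Fin n

countTrue-cong : {f g : Fin n → Bool} → f ≗ g → countTrue f ≡ countTrue g
countTrue-cong {zero}  f≗g = refl
countTrue-cong {suc n} f≗g =
  cong₂ (λ x c → (if x then 1 else 0) + c) (f≗g zero) (countTrue-cong (f≗g ∘ suc))

countTrue-mono : {f g : Fin n → Bool} → (∀ i → f i ≡ true → g i ≡ true) →
                 countTrue f ≤ countTrue g
countTrue-mono {zero} f⇒g = z≤n
countTrue-mono {suc n} {f} {g} f⇒g with f zero in fz | g zero in gz
... | true  | true  = s≤s (countTrue-mono (f⇒g ∘ suc))
... | true  | false with () ← trans (sym (f⇒g zero fz)) gz
... | false | true  = m≤n⇒m≤1+n (countTrue-mono (f⇒g ∘ suc))
... | false | false = countTrue-mono (f⇒g ∘ suc)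

countTrue≤n : (f : Fin n → Bool) → countTrue f ≤ n
countTrue≤n {zero}  f = z≤n
countTrue≤n {suc n} f with f zero
... | true  = s≤s (countTrue≤n (f ∘ suc))
... | false = m≤n⇒m≤1+n (countTrue≤n (f ∘ suc))

countTrue-false : {f : Fin n → Bool} → (∀ i → f i ≡ false) → countTrue f ≡ 0
countTrue-false {zero}  f≡false = refl
countTrue-false {suc n} f≡false rewrite f≡false zero = countTrue-false (f≡false ∘ suc)

countTrue>0 : (f : Fin n → Bool) {i : Fin n} → f i ≡ true → 0 < countTrue f
countTrue>0 f {zero}  fi rewrite fi = s≤s z≤n
countTrue>0 f {suc i} fi = ≤-trans (countTrue>0 (f ∘ suc) fi) (m≤n+m _ _)

countTrue>0⁻ : (f : Fin n → Bool) → 0 < countTrue f → ∃ λ i → f i ≡ true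
countTrue>0⁻ {suc n} f pos with f zero in fz
... | true  = zero , fz
... | false = let i , fi = countTrue>0⁻ (f ∘ suc) pos in suc i , fi

countTrue-suc : (f g : Fin n → Bool) (i : Fin n) → f i ≡ false → g i ≡ true →
                (∀ j → i ≢ j → f j ≡ g j) → countTrue g ≡ suc (countTrue f)
countTrue-suc f g zero fi gi f≡g rewrite fi | gi =
  cong suc (countTrue-cong (λ j → sym (f≡g (suc j) λ ())))
countTrue-suc f g (suc i) fi gi f≡g rewrite f≡g zero (λ ()) =
  trans (cong ((if g zero then 1 else 0) +_)
              (countTrue-suc (f ∘ suc) (g ∘ suc) i fi gi λ j i≢j → f≡g (suc j) (i≢j ∘ Finₚ.suc-injective)))
        (+-suc _ _)

countTrue≡∣tabulate∣ : (f : Fin n → Bool) → countTrue f ≡ ∣ tabulate f ∣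
countTrue≡∣tabulate∣ {zero}  f = refl
countTrue≡∣tabulate∣ {suc n} f with f zero
... | true  = cong suc (countTrue≡∣tabulate∣ (f ∘ suc))
... | false = countTrue≡∣tabulate∣ (f ∘ suc)

∈-tabulate : (f : Fin n → Bool) {i : Fin n} → f i ≡ true → i ∈ tabulate f
∈-tabulate f {i} fi = lookup⇒[]= i (tabulate f) (trans (lookup∘tabulate f i) fi)

injection⇒≤∣S∣ : (S : Subset n) (g : Fin m → Fin n) → (∀ {i j} → g i ≡ g j → i ≡ j) →
                  (∀ i → g i ∈ S) → m ≤ ∣ S ∣
injection⇒≤∣S∣ {m = zero}  S g g-inj g∈S = z≤n
injection⇒≤∣S∣ {m = suc m} S g g-inj g∈S =
  <-≤-trans (s≤s (injection⇒≤∣S∣ (S - g zero) (g ∘ suc) (Finₚ.suc-injective ∘ g-inj) g∈S-g0))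
            (x∈p⇒∣p-x∣<∣p∣ (g∈S zero))
  where
  g∈S-g0 : ∀ i → g (suc i) ∈ S - g zero
  g∈S-g0 i = x∈p∧x≢y⇒x∈p-y (g∈S (suc i)) (λ g≡ → Finₚ.0≢1+n (g-inj (sym g≡)))

pigeonhole : (S : Subset n) (P : Fin m → Fin n → Set) → (∀ c u → Dec (P c u)) →
             (∀ {c c′ u} → P c u → P c′ u → c ≡ c′) → ∣ S ∣ < m →
             ∃ λ c → ∀ u → u ∈ S → ¬ P c u
pigeonhole {n = n} {m = m} S P P? disjoint ∣S∣<m
  with any? (λ c → ¬? (any? λ u → u ∈? S ×-dec P? c u))
... | yes (c , unhit) = c , λ u u∈S Pcu → unhit (u , u∈S , Pcu)
... | no  ¬unhit      =
  contradiction (injection⇒≤∣S∣ S g g-injective (proj₁ ∘ proj₂ ∘ hit)) (<⇒≱ ∣S∣<m)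
  where
  hit : ∀ c → ∃ λ u → u ∈ S × P c u
  hit c = decidable-stable (any? λ u → u ∈? S ×-dec P? c u) λ unhit → ¬unhit (c , unhit)
  g : Fin m → Fin n
  g = proj₁ ∘ hit
  g-injective : ∀ {c c′} → g c ≡ g c′ → c ≡ c′
  g-injective {c} {c′} gc≡gc′ =
    disjoint (proj₂ (proj₂ (hit c))) (subst (P c′) (sym gc≡gc′) (proj₂ (proj₂ (hit c′))))

argmax : {P : Fin n → Set} → Decidable P → (s : Fin n → ℕ) →
         (∀ i → ¬ P i) ⊎ ∃ λ y → P y × ∀ i → P i → s i ≤ s y
argmax {zero} P? s = inj₁ λ ()
argmax {suc n} P? s with argmax (P? ∘ suc) (s ∘ suc) | P? zero
... | inj₁ none | no ¬P0 = inj₁ λ { zero → ¬P0 ; (suc i) → none i }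
... | inj₁ none | yes P0 = inj₂ (zero , P0 , λ { zero _ → ≤-refl ; (suc i) Pi → contradiction Pi (none i) })
... | inj₂ (y , Py , max) | no ¬P0 =
  inj₂ (suc y , Py , λ { zero P0 → contradiction P0 ¬P0 ; (suc i) Pi → max i Pi })
... | inj₂ (y , Py , max) | yes P0 with s zero ≤? s (suc y)
...   | yes s0≤sy = inj₂ (suc y , Py , λ { zero _ → s0≤sy ; (suc i) Pi → max i Pi })
...   | no  s0≰sy = inj₂ (zero , P0 , λ { zero _ → ≤-refl
                                        ; (suc i) Pi → ≤-trans (max i Pi) (<⇒≤ (≰⇒> s0≰sy)) })

sum-mono : {f g : Fin n → ℕ} → (∀ i → f i ≤ g i) → sum f ≤ sum g
sum-mono {zero}  f≤g = z≤n
sum-mono {suc n} f≤g = +-mono-≤ (f≤g zero) (sum-mono (f≤g ∘ suc))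

≤-sum : (f : Fin n → ℕ) (i : Fin n) → f i ≤ sum f
≤-sum f zero    = m≤m+n _ _
≤-sum f (suc i) = ≤-trans (≤-sum (f ∘ suc) i) (m≤n+m _ _)

sum-1 : (n : ℕ) → sum {n} (λ _ → 1) ≡ n
sum-1 zero    = refl
sum-1 (suc n) = cong suc (sum-1 n)

∣⁅x⁆∪p∣≤1+∣p∣ : (x : Fin n) (p : Subset n) → ∣ ⁅ x ⁆ ∪ p ∣ ≤ suc ∣ p ∣
∣⁅x⁆∪p∣≤1+∣p∣ zero    (s ∷ p) =
  s≤s (subst (_≤ ∣ s ∷ p ∣) (cong ∣_∣ (sym (∪-identityˡ p))) (∣p∣≤∣x∷p∣ s p))
∣⁅x⁆∪p∣≤1+∣p∣ (suc x) (true  ∷ p) = s≤s (∣⁅x⁆∪p∣≤1+∣p∣ x p)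
∣⁅x⁆∪p∣≤1+∣p∣ (suc x) (false ∷ p) = ∣⁅x⁆∪p∣≤1+∣p∣ x p

-- Closed neighbourhoods and claims

closedNbhd : Graph n → Fin n → Fin n → Bool
closedNbhd G v u = does (v ≟ u) ∨ adj G v u

closedNbhd-self : (G : Graph n) (v : Fin n) → closedNbhd G v v ≡ true
closedNbhd-self G v rewrite dec-true (v ≟ v) refl = refl

closedNbhd-adj : (G : Graph n) {v u : Fin n} → adj G v u ≡ true → closedNbhd G v u ≡ true
closedNbhd-adj G {v} {u} v∼u rewrite v∼u = ∨-zeroʳ (does (v ≟ u))

closedNbhd⁻ : (G : Graph n) {v u : Fin n} → closedNbhd G v u ≡ true → v ≡ u ⊎ adj G v u ≡ true
closedNbhd⁻ G {v} {u} u∈N[v] with v ≟ u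
... | yes v≡u = inj₁ v≡u
... | no  _   = inj₂ u∈N[v]

closedNbhd-sym : (G : Graph n) (u v : Fin n) → closedNbhd G u v ≡ closedNbhd G v u
closedNbhd-sym G u v = cong₂ _∨_ (does-⇔ (mk⇔ sym sym) (u ≟ v) (v ≟ u)) (adj-sym G u v)

countTrue-closedNbhd : (G : Graph n) (v : Fin n) → countTrue (closedNbhd G v) ≡ suc (degree G v)
countTrue-closedNbhd G v =
  countTrue-suc (adj G v) (closedNbhd G v) v (irrefl G v) (closedNbhd-self G v)
                (λ u v≢u → cong (_∨ adj G v u) (sym (dec-false (v ≟ u) v≢u)))

isDom isStal : Owner → Bool
isDom dom = true
isDom _   = false
isStal stal = true
isStal _    = false

isDom⁻ : ∀ {o} → isDom o ≡ true → o ≡ dom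
isDom⁻ {dom} _ = refl

free? : (o : Owner) → Dec (o ≡ free)
free? free = yes refl
free? dom  = no λ ()
free? stal = no λ ()

isFree : Owner → Bool
isFree o = does (free? o)

Dominated : Graph n → Position n → Fin n → Set
Dominated G p v = ∃ λ u → closedNbhd G v u ≡ true × p u ≡ dom

dominating⇒dominated : (G : Graph n) {p : Position n} → DomHasDominating G p → ∀ v → Dominated G p v
dominating⇒dominated G (D , D⊆dom , D-dominating) v with D-dominating v
... | inj₁ v∈D             = v , closedNbhd-self G v , D⊆dom v v∈D
... | inj₂ (u , v∼u , u∈D) = u , closedNbhd-adj G v∼u , D⊆dom u u∈D

dominated⇒dominating : (G : Graph n) {p : Position n} → (∀ v → Dominated G p v) → DomHasDominating G p
dominated⇒dominating {n = n} G {p} dominated = D , D⊆dom , D-dominating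
  where
  D : Subset n
  D = tabulate (isDom ∘ p)
  D⊆dom : ∀ v → v ∈ D → p v ≡ dom
  D⊆dom v v∈D = isDom⁻ (trans (sym (lookup∘tabulate (isDom ∘ p) v)) ([]=⇒lookup v∈D))
  D-dominating : IsDominating G D
  D-dominating v with dominated v
  ... | u , u∈N[v] , pu with closedNbhd⁻ G u∈N[v]
  ...   | inj₁ refl = inj₁ (∈-tabulate (isDom ∘ p) (cong isDom pu))
  ...   | inj₂ v∼u  = inj₂ (u , v∼u , ∈-tabulate (isDom ∘ p) (cong isDom pu))

StallerOwnsNbhd : Graph n → Position n → Fin n → Set
StallerOwnsNbhd G p v = ∀ u → closedNbhd G v u ≡ true → p u ≡ stal

ownsNbhd⇒¬dominating : (G : Graph n) {p : Position n} {v : Fin n} →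
                        StallerOwnsNbhd G p v → ¬ DomHasDominating G p
ownsNbhd⇒¬dominating G {v = v} owns dominating with dominating⇒dominated G dominating v
... | u , u∈N[v] , pu with () ← trans (sym (owns u u∈N[v])) pu

claimVertex-self : (p : Position n) (v : Fin n) → claimVertex p v v ≡ stal
claimVertex-self p v with v ≟ v
... | yes _   = refl
... | no  v≢v = contradiction refl v≢v

claimVertex-other : (p : Position n) {v u : Fin n} → v ≢ u → claimVertex p v u ≡ p u
claimVertex-other p {v} {u} v≢u with v ≟ u
... | yes v≡u = contradiction v≡u v≢u
... | no  _   = refl

claimVertex-stal : (p : Position n) {v u : Fin n} → p u ≡ stal → claimVertex p v u ≡ stal
claimVertex-stal p {v} {u} pu with v ≟ u
... | yes _ = refl
... | no  _ = pu

claimSet-∈ : (p : Position n) {S : Subset n} {v : Fin n} → v ∈ S → claimSet p S v ≡ dom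
claimSet-∈ p v∈S rewrite []=⇒lookup v∈S = refl

claimSet-∉ : (p : Position n) {S : Subset n} {v : Fin n} → v ∉ S → claimSet p S v ≡ p v
claimSet-∉ p {S} {v} v∉S with lookup S v in Sv
... | true  = contradiction (lookup⇒[]= v S Sv) v∉S
... | false = refl

claimSet-free⁻ : (p : Position n) (S : Subset n) {v : Fin n} → claimSet p S v ≡ free → p v ≡ free
claimSet-free⁻ p S {v} qv with lookup S v
... | false = qv

claimSet-∪ : (p : Position n) (T S : Subset n) → claimSet p (T ∪ S) ≗ claimSet (claimSet p T) S
claimSet-∪ p T S u with u ∈? S | u ∈? T
... | yes u∈S | _       = trans (claimSet-∈ p (x∈p∪q⁺ {p = T} (inj₂ u∈S)))
                                (sym (claimSet-∈ (claimSet p T) u∈S))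
... | no  u∉S | yes u∈T = trans (claimSet-∈ p (x∈p∪q⁺ (inj₁ u∈T)))
                                (sym (trans (claimSet-∉ (claimSet p T) u∉S) (claimSet-∈ p u∈T)))
... | no  u∉S | no  u∉T = trans (claimSet-∉ p (Sum.[ u∉T , u∉S ] ∘ x∈p∪q⁻ T S))
                                (sym (trans (claimSet-∉ (claimSet p T) u∉S) (claimSet-∉ p u∉T)))

claimSet-stal : {b : ℕ} {p : Position n} {S : Subset n} → LegalDomMove b p S →
                ∀ {u} → p u ≡ stal → claimSet p S u ≡ stal
claimSet-stal {p = p} (_ , _ , S⊆free) pu =
  trans (claimSet-∉ p λ u∈S → contradiction (trans (sym pu) (S⊆free _ u∈S)) λ ()) pu

freeCount : Position n → ℕ
freeCount p = countTrue (isFree ∘ p)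

freeCount>0 : {p : Position n} {v : Fin n} → p v ≡ free → 0 < freeCount p
freeCount>0 {p = p} pv = countTrue>0 (isFree ∘ p) (cong isFree pv)

freeCount-claimSet : (p : Position n) (S : Subset n) → freeCount (claimSet p S) ≤ freeCount p
freeCount-claimSet p S = countTrue-mono still-free
  where
  still-free : ∀ u → isFree (claimSet p S u) ≡ true → isFree (p u) ≡ true
  still-free u qu with lookup S u
  ... | false = qu

freeCount-claimVertex : (p : Position n) {v : Fin n} {k : ℕ} → p v ≡ free →
                        freeCount p ≤ suc k → freeCount (claimVertex p v) ≤ k
freeCount-claimVertex p {v} pv free≤1+k = s≤s⁻¹ (subst (_≤ _) count-suc free≤1+k)
  where
  count-suc : freeCount p ≡ suc (freeCount (claimVertex p v))
  count-suc = countTrue-suc _ (isFree ∘ p) v (cong isFree (claimVertex-self p v)) (cong isFree pv)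
                            (λ u v≢u → cong isFree (claimVertex-other p v≢u))

hasFree? : (p : Position n) → Dec (HasFree p)
hasFree? p = any? (free? ∘ p)

module _ (G : Graph n) (b : ℕ) where

  mutual
    ownsNbhd⇒StWinsD : ∀ k {p v} → freeCount p ≤ k → StallerOwnsNbhd G p v → StWinsD G b p
    ownsNbhd⇒StWinsD k {p} free≤k owns = step (ownsNbhd⇒¬dominating G owns) λ S legal →
      ownsNbhd⇒StWinsS k (≤-trans (freeCount-claimSet p S) free≤k) (λ u → claimSet-stal legal ∘ owns u)

    ownsNbhd⇒StWinsS : ∀ k {p v} → freeCount p ≤ k → StallerOwnsNbhd G p v → StWinsS G b p
    ownsNbhd⇒StWinsS k {p} free≤k owns with hasFree? p
    ... | no noFree = over (ownsNbhd⇒¬dominating G owns) noFree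
    ownsNbhd⇒StWinsS zero    {p} free≤0   owns | yes (x , px) =
      contradiction free≤0 (<⇒≱ (freeCount>0 {p = p} px))
    ownsNbhd⇒StWinsS (suc k) {p} free≤1+k owns | yes (x , px) =
      step (ownsNbhd⇒¬dominating G owns) x px
           (ownsNbhd⇒StWinsD k (freeCount-claimVertex p px free≤1+k)
                                 (λ u → claimVertex-stal p {x} ∘ owns u))

-- Dominator's strategy

module Potential (G : Graph n) (b : ℕ) where

  nbhdCount : (Owner → Bool) → Position n → Fin n → ℕ
  nbhdCount P p v = countTrue (λ u → closedNbhd G v u ∧ P (p u))

  nbhdCount>0 : (P : Owner → Bool) (p : Position n) {v u : Fin n} →
                closedNbhd G v u ≡ true → P (p u) ≡ true → 0 < nbhdCount P p v
  nbhdCount>0 P p {u = u} u∈N[v] Ppu = countTrue>0 _ {u} (cong₂ _∧_ u∈N[v] Ppu)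

  nbhdCount≡0⁻ : (P : Owner → Bool) (p : Position n) {v u : Fin n} →
                 nbhdCount P p v ≡ 0 → closedNbhd G v u ≡ true → P (p u) ≡ false
  nbhdCount≡0⁻ P p {u = u} count≡0 u∈N[v] with P (p u) in Ppu
  ... | false = refl
  ... | true  = contradiction count≡0 (>⇒≢ (nbhdCount>0 P p u∈N[v] Ppu))

  nbhdCount>0⁻ : (P : Owner → Bool) (p : Position n) {v : Fin n} → 0 < nbhdCount P p v →
                 ∃ λ u → closedNbhd G v u ≡ true × P (p u) ≡ true
  nbhdCount>0⁻ P p {v} pos with countTrue>0⁻ _ pos
  ... | u , h with closedNbhd G v u in u∈N[v] | P (p u) in Ppu
  ...   | true | true = u , u∈N[v] , Ppu

  nbhdCount-local : (P : Owner → Bool) {p q : Position n} {v : Fin n} →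
                    (∀ u → closedNbhd G v u ≡ true → q u ≡ p u) → nbhdCount P q v ≡ nbhdCount P p v
  nbhdCount-local P {p} {q} {v} q≡p = countTrue-cong agree
    where
    agree : ∀ u → (closedNbhd G v u ∧ P (q u)) ≡ (closedNbhd G v u ∧ P (p u))
    agree u with closedNbhd G v u in u∈N[v]
    ... | true  = cong P (q≡p u u∈N[v])
    ... | false = refl

  weightOf : ℕ → ℕ → ℕ
  weightOf zero    s = suc b ^ s
  weightOf (suc _) s = 0

  weight : Position n → Fin n → ℕ
  weight p v = weightOf (nbhdCount isDom p v) (nbhdCount isStal p v)

  Φ : Position n → ℕ
  Φ p = sum (weight p)

  weight∋ : Position n → Fin n → Fin n → ℕ
  weight∋ p x v = if closedNbhd G v x then weight p v else 0

  danger : Position n → Fin n → ℕ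
  danger p x = sum (weight∋ p x)

  weightOf-suc : ∀ d s → weightOf d (suc s) ≡ weightOf d s + b * weightOf d s
  weightOf-suc zero    s = refl
  weightOf-suc (suc d) s = sym (*-zeroʳ b)

  weight-local : {p q : Position n} {v : Fin n} →
                 (∀ u → closedNbhd G v u ≡ true → q u ≡ p u) → weight q v ≡ weight p v
  weight-local q≡p = cong₂ weightOf (nbhdCount-local isDom q≡p) (nbhdCount-local isStal q≡p)

  weight-dominated : {p : Position n} {v u : Fin n} →
                     closedNbhd G v u ≡ true → p u ≡ dom → weight p v ≡ 0
  weight-dominated {p} {v} u∈N[v] pu
    with nbhdCount isDom p v | nbhdCount>0 isDom p u∈N[v] (cong isDom pu)
  ... | suc _ | _ = refl

  weight-owned : {p : Position n} {v : Fin n} → StallerOwnsNbhd G p v →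
                 weight p v ≡ suc b ^ suc (degree G v)
  weight-owned {p} {v} owns = cong₂ weightOf no-dom all-stal
    where
    owned : ∀ P u → (closedNbhd G v u ∧ P (p u)) ≡ (closedNbhd G v u ∧ P stal)
    owned P u with closedNbhd G v u in u∈N[v]
    ... | true  = cong P (owns u u∈N[v])
    ... | false = refl
    no-dom : nbhdCount isDom p v ≡ 0
    no-dom = countTrue-false λ u → trans (owned isDom u) (∧-zeroʳ _)
    all-stal : nbhdCount isStal p v ≡ suc (degree G v)
    all-stal = trans (countTrue-cong λ u → trans (owned isStal u) (∧-identityʳ _))
                     (countTrue-closedNbhd G v)

  weight-claimSet : (p : Position n) (S : Subset n) (v : Fin n) → weight (claimSet p S) v ≤ weight p v
  weight-claimSet p S v with nbhdCount isDom (claimSet p S) v in count≡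
  ... | suc _ = z≤n
  ... | zero  = ≤-reflexive (trans (cong (λ d → weightOf d (nbhdCount isStal (claimSet p S) v)) (sym count≡))
                                   (weight-local unclaimed))
    where
    unclaimed : ∀ u → closedNbhd G v u ≡ true → claimSet p S u ≡ p u
    unclaimed u u∈N[v] = claimSet-∉ p λ u∈S →
      contradiction (trans (sym (cong isDom (claimSet-∈ p {S} u∈S))) (nbhdCount≡0⁻ isDom _ count≡ u∈N[v]))
                    λ ()

  Φ-claimSet : (p : Position n) (S : Subset n) → Φ (claimSet p S) ≤ Φ p
  Φ-claimSet p S = sum-mono (weight-claimSet p S)

  danger-claimSet : (p : Position n) (S : Subset n) (x : Fin n) → danger (claimSet p S) x ≤ danger p x
  danger-claimSet p S x = sum-mono term-claimSet
    where
    term-claimSet : ∀ v → weight∋ (claimSet p S) x v ≤ weight∋ p x v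
    term-claimSet v with closedNbhd G v x
    ... | true  = weight-claimSet p S v
    ... | false = ≤-refl

  Φ-cong : {p q : Position n} → p ≗ q → Φ p ≡ Φ q
  Φ-cong p≗q = sum-cong-≗ λ v → weight-local {v = v} λ u _ → p≗q u

  danger-cong : {p q : Position n} → p ≗ q → ∀ x → danger p x ≡ danger q x
  danger-cong p≗q x =
    sum-cong-≗ λ v → cong (if closedNbhd G v x then_else 0) (weight-local {v = v} λ u _ → p≗q u)

  Φ-claimDom : (p : Position n) (y : Fin n) → Φ (claimSet p ⁅ y ⁆) + danger p y ≡ Φ p
  Φ-claimDom p y = trans (sym (∑-distrib-+ (weight (claimSet p ⁅ y ⁆)) (weight∋ p y))) (sum-cong-≗ term)
    where
    term : ∀ v → weight (claimSet p ⁅ y ⁆) v + weight∋ p y v ≡ weight p v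
    term v with closedNbhd G v y in y∈N[v]
    ... | true  = cong (_+ weight p v) (weight-dominated y∈N[v] (claimSet-∈ p (x∈⁅x⁆ y)))
    ... | false = trans (+-identityʳ _) (weight-local λ u u∈N[v] → claimSet-∉ p λ u∈⁅y⁆ →
                    contradiction (trans (sym (subst (λ z → closedNbhd G v z ≡ true) (x∈⁅y⁆⇒x≡y y u∈⁅y⁆)
                                                     u∈N[v]))
                                         y∈N[v])
                                  λ ())

  Φ-claimVertex : (p : Position n) {x : Fin n} → p x ≡ free → Φ (claimVertex p x) ≡ Φ p + b * danger p x
  Φ-claimVertex p {x} px = begin
    Φ p′                                      ≡⟨ sum-cong-≗ term ⟩
    sum (λ v → weight p v + b * weight∋ p x v) ≡⟨ ∑-distrib-+ (weight p) _ ⟩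
    Φ p + sum (λ v → b * weight∋ p x v)        ≡⟨ cong (Φ p +_) (*-distribˡ-sum b (weight∋ p x)) ⟨
    Φ p + b * danger p x                       ∎
    where
    open ≡-Reasoning
    p′ : Position n
    p′ = claimVertex p x
    same-dom : ∀ u → isDom (p′ u) ≡ isDom (p u)
    same-dom u with x ≟ u
    ... | yes refl = cong isDom (sym px)
    ... | no  _    = refl
    term : ∀ v → weight p′ v ≡ weight p v + b * weight∋ p x v
    term v with closedNbhd G v x in x∈N[v]
    ... | false = trans (weight-local λ u u∈N[v] → claimVertex-other p {x} λ { refl →
                           contradiction (trans (sym u∈N[v]) x∈N[v]) λ () })
                        (sym (trans (cong (weight p v +_) (*-zeroʳ b)) (+-identityʳ _)))
    ... | true  = trans (cong₂ weightOf dom-count stal-count)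
                        (weightOf-suc (nbhdCount isDom p v) (nbhdCount isStal p v))
      where
      dom-count : nbhdCount isDom p′ v ≡ nbhdCount isDom p v
      dom-count = countTrue-cong λ u → cong (closedNbhd G v u ∧_) (same-dom u)
      stal-count : nbhdCount isStal p′ v ≡ suc (nbhdCount isStal p v)
      stal-count = countTrue-suc _ _ x (cong₂ _∧_ x∈N[v] (cong isStal px))
                                       (cong₂ _∧_ x∈N[v] (cong isStal (claimVertex-self p x)))
                                       (λ u x≢u → cong (λ o → closedNbhd G v u ∧ isStal o)
                                                       (sym (claimVertex-other p x≢u)))

  record GreedyMove (j : ℕ) (p : Position n) : Set where
    field
      claims          : Subset n
      claims⊆free     : ∀ v → v ∈ claims → p v ≡ free
      ∣claims∣≤j      : ∣ claims ∣ ≤ j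
      claims-nonempty : 0 < j → HasFree p → Nonempty claims
      potential-drop  : ∀ x → claimSet p claims x ≡ free →
                        Φ (claimSet p claims) + j * danger (claimSet p claims) x ≤ Φ p

  -- Claim, one at a time, a free vertex of maximal danger: each claim lowers Φ by at least the
  -- danger of any vertex still free at the end, as dangers only decrease along the way.
  greedyMove : ∀ j p → GreedyMove j p
  greedyMove zero p = record
    { claims          = ⊥
    ; claims⊆free     = λ _ v∈⊥ → contradiction v∈⊥ ∉⊥
    ; ∣claims∣≤j      = ≤-reflexive (∣⊥∣≡0 n)
    ; claims-nonempty = λ ()
    ; potential-drop  = λ _ _ → ≤-trans (≤-reflexive (+-identityʳ _)) (Φ-claimSet p ⊥)
    }
  greedyMove (suc j) p with argmax (free? ∘ p) (danger p)
  ... | inj₁ noFree = record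
    { claims          = ⊥
    ; claims⊆free     = λ _ v∈⊥ → contradiction v∈⊥ ∉⊥
    ; ∣claims∣≤j      = ≤-trans (≤-reflexive (∣⊥∣≡0 n)) z≤n
    ; claims-nonempty = λ _ (x , px) → contradiction px (noFree x)
    ; potential-drop  = λ x qx → contradiction (claimSet-free⁻ p ⊥ qx) (noFree x)
    }
  ... | inj₂ (y , py , y-max) = record
    { claims          = ⁅ y ⁆ ∪ S′
    ; claims⊆free     = λ v v∈S →
        Sum.[ (λ v∈⁅y⁆ → subst (λ z → p z ≡ free) (sym (x∈⁅y⁆⇒x≡y y v∈⁅y⁆)) py)
            , (λ v∈S′ → claimSet-free⁻ p ⁅ y ⁆ (claims⊆free v v∈S′)) ]
            (x∈p∪q⁻ ⁅ y ⁆ S′ v∈S)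
    ; ∣claims∣≤j      = ≤-trans (∣⁅x⁆∪p∣≤1+∣p∣ y S′) (s≤s ∣claims∣≤j)
    ; claims-nonempty = λ _ _ → y , x∈p∪q⁺ (inj₁ (x∈⁅x⁆ y))
    ; potential-drop  = lowers
    }
    where
    p₁ : Position n
    p₁ = claimSet p ⁅ y ⁆
    open GreedyMove (greedyMove j p₁) renaming (claims to S′)
    q : Position n
    q = claimSet p (⁅ y ⁆ ∪ S′)
    q≗ : q ≗ claimSet p₁ S′
    q≗ = claimSet-∪ p ⁅ y ⁆ S′
    lowers : ∀ x → q x ≡ free → Φ q + suc j * danger q x ≤ Φ p
    lowers x qx = begin
      Φ q + (danger q x + j * danger q x)  ≡⟨ x∙yz≈y∙xz (Φ q) (danger q x) (j * danger q x) ⟩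
      danger q x + (Φ q + j * danger q x)  ≤⟨ +-mono-≤ danger≤ lowers′ ⟩
      danger p y + Φ p₁                    ≡⟨ +-comm (danger p y) (Φ p₁) ⟩
      Φ p₁ + danger p y                    ≡⟨ Φ-claimDom p y ⟩
      Φ p                                  ∎
      where
      open ≤-Reasoning
      danger≤ : danger q x ≤ danger p y
      danger≤ = ≤-trans (danger-claimSet p (⁅ y ⁆ ∪ S′) x)
                        (y-max x (claimSet-free⁻ p (⁅ y ⁆ ∪ S′) qx))
      lowers′ : Φ q + j * danger q x ≤ Φ p₁
      lowers′ = subst (_≤ Φ p₁) (sym (cong₂ (λ φ d → φ + j * d) (Φ-cong q≗) (danger-cong q≗ x)))
                      (potential-drop x (trans (sym (q≗ x)) qx))

  allClaimed⇒dominating : MinDegAboveLogMinus G b 1 → {p : Position n} → ¬ HasFree p → Φ p ≤ n →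
                          DomHasDominating G p
  allClaimed⇒dominating minDeg {p} noFree Φ≤n = dominated⇒dominating G dominated
    where
    dominated : ∀ v → Dominated G p v
    dominated v with nbhdCount isDom p v in count≡
    ... | suc _ = let u , u∈N[v] , pu = nbhdCount>0⁻ isDom p (subst (0 <_) (sym count≡) (s≤s z≤n))
                  in u , u∈N[v] , isDom⁻ pu
    ... | zero = contradiction (minDeg v) (≤⇒≯ heavy)
      where
      owns : StallerOwnsNbhd G p v
      owns u u∈N[v] with p u in pu | nbhdCount≡0⁻ isDom p count≡ u∈N[v]
      ... | free | _ = contradiction (u , pu) noFree
      ... | stal | _ = refl
      heavy : suc b ^ (degree G v + 1) ≤ n
      heavy = begin
        suc b ^ (degree G v + 1) ≡⟨ cong (suc b ^_) (+-comm (degree G v) 1) ⟩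
        suc b ^ suc (degree G v) ≡⟨ weight-owned owns ⟨
        weight p v               ≤⟨ ≤-sum (weight p) v ⟩
        Φ p                      ≤⟨ Φ≤n ⟩
        n                        ∎
        where open ≤-Reasoning

  dominatorWinsFrom : MinDegAboveLogMinus G b 1 → 0 < b →
                      ∀ k {p} → freeCount p ≤ k → Φ p ≤ n → DomWinsD G b p
  dominatorWinsFrom minDeg b>0 k {p} free≤k Φ≤n with hasFree? p
  ... | no noFree = done (allClaimed⇒dominating minDeg noFree Φ≤n)
  dominatorWinsFrom minDeg b>0 zero    {p} free≤0   Φ≤n | yes (x , px) =
    contradiction free≤0 (<⇒≱ (freeCount>0 {p = p} px))
  dominatorWinsFrom minDeg b>0 (suc k) {p} free≤1+k Φ≤n | yes hasFree =
    move S (claims-nonempty b>0 hasFree , ∣claims∣≤j , claims⊆free) staller-to-move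
    where
    open GreedyMove (greedyMove b p) renaming (claims to S)
    q : Position n
    q = claimSet p S
    staller-to-move : DomWinsS G b q
    staller-to-move with hasFree? q
    ... | no noFree    = done (allClaimed⇒dominating minDeg noFree (≤-trans (Φ-claimSet p S) Φ≤n))
    ... | yes qHasFree = reply qHasFree λ x qx →
      dominatorWinsFrom minDeg b>0 k
        (freeCount-claimVertex q qx (≤-trans (freeCount-claimSet p S) free≤1+k))
        (begin
          Φ (claimVertex q x)  ≡⟨ Φ-claimVertex q qx ⟩
          Φ q + b * danger q x ≤⟨ potential-drop x qx ⟩
          Φ p                  ≤⟨ Φ≤n ⟩
          n                    ∎)
      where open ≤-Reasoning

  Φ-start : Φ start ≡ n
  Φ-start = trans (sum-cong-≗ weight-start) (sum-1 n)
    where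
    weight-start : ∀ v → weight start v ≡ 1
    weight-start v = cong (λ c → weightOf c c) (countTrue-false λ u → ∧-zeroʳ (closedNbhd G v u))

  dominatorWins : 0 < b → MinDegAboveLogMinus G b 1 → DominatorWins G b
  dominatorWins b>0 minDeg = dominatorWinsFrom minDeg b>0 n (countTrue≤n _) (≤-reflexive Φ-start)

-- Staller's strategy on a tree of words

module _ {A : Set} where

  infix 4 _≼_
  _≼_ : List A → List A → Set
  _≼_ = Prefix _≡_

  ≼-refl : {l : List A} → l ≼ l
  ≼-refl = fromPointwise (Pointwise.refl refl)

  ≼-trans : {l m r : List A} → l ≼ m → m ≼ r → l ≼ r
  ≼-trans = Prefixₚ.trans trans

  ≼-++ : (l r : List A) → l ≼ l ++ r
  ≼-++ l r = ≼-refl ++ᵖ r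

  take-≼ : (i : ℕ) (l : List A) → take i l ≼ l
  take-≼ i l = subst (take i l ≼_) (take++drop≡id i l) (≼-++ (take i l) (drop i l))

  ≼-antisym-length : {l m : List A} → l ≼ m → length m ≤ length l → l ≡ m
  ≼-antisym-length l≼m m≤l = Pointwise-≡⇒≡ (toPointwise (≤-antisym (length-mono l≼m) m≤l) l≼m)

  Comparable : List A → List A → Set
  Comparable l m = l ≼ m ⊎ m ≼ l

  ≼-total-below : {l m L : List A} → l ≼ L → m ≼ L → Comparable l m
  ≼-total-below []            _             = inj₁ []
  ≼-total-below (_ ∷ _)       []            = inj₂ []
  ≼-total-below (refl ∷ l≼L) (refl ∷ m≼L) = Sum.map (refl ∷_) (refl ∷_) (≼-total-below l≼L m≼L)

  length-∷ʳ : (w : List A) (c : A) → length (w ∷ʳ c) ≡ suc (length w)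
  length-∷ʳ w c = trans (length-++ w) (+-comm (length w) 1)

  ∷ʳ-≼⁻ : {w x : List A} {c : A} → w ∷ʳ c ≼ x → w ≼ x
  ∷ʳ-≼⁻ {w} {c = c} = ≼-trans (≼-++ w [ c ])

  ≼-∷ʳ⁻ : {l w : List A} {c : A} → l ≼ w ∷ʳ c → l ≼ w ⊎ l ≡ w ∷ʳ c
  ≼-∷ʳ⁻ {w = []}    []          = inj₁ []
  ≼-∷ʳ⁻ {w = []}    (refl ∷ []) = inj₂ refl
  ≼-∷ʳ⁻ {w = _ ∷ _} []          = inj₁ []
  ≼-∷ʳ⁻ {w = x ∷ _} (refl ∷ l≼) = Sum.map (refl ∷_) (cong (x ∷_)) (≼-∷ʳ⁻ l≼)

  ∷ʳ-≼-injective : {w x : List A} {c c′ : A} → w ∷ʳ c ≼ x → w ∷ʳ c′ ≼ x → c ≡ c′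
  ∷ʳ-≼-injective {w = []}    (refl ∷ _) (refl ∷ _) = refl
  ∷ʳ-≼-injective {w = _ ∷ _} (refl ∷ h) (refl ∷ h′) = ∷ʳ-≼-injective h h′

module PrefixTree (a : ℕ) where

  B : ℕ
  B = suc a

  Word : Set
  Word = List (Fin B)

  digits : ∀ d → Fin (B ^ d) → Word
  digits zero    _ = []
  digits (suc d) x = proj₁ (remQuot {B} (B ^ d) x) ∷ digits d (proj₂ (remQuot {B} (B ^ d) x))

  length-digits : ∀ d x → length (digits d x) ≡ d
  length-digits zero    _ = refl
  length-digits (suc d) x = cong suc (length-digits d _)

  digits-injective : ∀ d {x y} → digits d x ≡ digits d y → x ≡ y
  digits-injective zero    {zero} {zero} _ = refl
  digits-injective (suc d) {x} {y} eq with ∷-injective eq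
  ... | c≡ , cs≡ = begin
    x                                       ≡⟨ combine-remQuot {B} (B ^ d) x ⟨
    uncurry combine (remQuot {B} (B ^ d) x) ≡⟨ cong (uncurry combine) remQuot≡ ⟩
    uncurry combine (remQuot {B} (B ^ d) y) ≡⟨ combine-remQuot {B} (B ^ d) y ⟩
    y                                       ∎
    where
    open ≡-Reasoning
    remQuot≡ : remQuot {B} (B ^ d) x ≡ remQuot (B ^ d) y
    remQuot≡ = cong₂ _,_ c≡ (digits-injective d cs≡)

  undigits : (l : Word) → Fin (B ^ length l)
  undigits []      = zero
  undigits (c ∷ l) = combine c (undigits l)

  digits-onto : (l : Word) {d : ℕ} → length l ≡ d → ∃ λ x → digits d x ≡ l
  digits-onto l refl = undigits l , digits-undigits l
    where
    digits-undigits : ∀ l → digits (length l) (undigits l) ≡ l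
    digits-undigits []      = refl
    digits-undigits (c ∷ l) =
      trans (cong (λ (c′ , x) → c′ ∷ digits (length l) x) (remQuot-combine {B} {B ^ length l} c (undigits l)))
            (cong (c ∷_) (digits-undigits l))

  treeSize : ℕ → ℕ
  treeSize zero    = B ^ 1
  treeSize (suc k) = treeSize k + B ^ suc (suc k)

  -- Words of length at most k + 1 are numbered first, then the words of length k + 2 in base B.
  decode : ∀ k → Fin (treeSize k) → Word
  decode zero    = digits 1
  decode (suc k) = Sum.[ decode k , digits (suc (suc k)) ]′ ∘ splitAt (treeSize k)

  length-decode : ∀ k x → 1 ≤ length (decode k x) × length (decode k x) ≤ suc k
  length-decode zero    x rewrite length-digits 1 x = ≤-refl , ≤-refl
  length-decode (suc k) x with splitAt (treeSize k) x
  ... | inj₁ y = Product.map₂ m≤n⇒m≤1+n (length-decode k y)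
  ... | inj₂ y rewrite length-digits (suc (suc k)) y = s≤s z≤n , ≤-refl

  decode-shallower : ∀ k x y → length (decode k x) ≢ length (digits (suc (suc k)) y)
  decode-shallower k x y eq =
    <-irrefl (trans eq (length-digits _ y)) (s≤s (proj₂ (length-decode k x)))

  decode-injective : ∀ k {x y} → decode k x ≡ decode k y → x ≡ y
  decode-injective zero eq = digits-injective 1 eq
  decode-injective (suc k) {x} {y} eq with splitAt (treeSize k) x in sx | splitAt (treeSize k) y in sy
  ... | inj₁ x′ | inj₁ y′ =
    trans (sym (splitAt⁻¹-↑ˡ sx)) (trans (cong (_↑ˡ _) (decode-injective k eq)) (splitAt⁻¹-↑ˡ sy))
  ... | inj₂ x′ | inj₂ y′ =
    trans (sym (splitAt⁻¹-↑ʳ sx))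
          (trans (cong (treeSize k ↑ʳ_) (digits-injective _ eq)) (splitAt⁻¹-↑ʳ sy))
  ... | inj₁ x′ | inj₂ y′ = contradiction (cong length eq) (decode-shallower k x′ y′)
  ... | inj₂ x′ | inj₁ y′ = contradiction (cong length (sym eq)) (decode-shallower k y′ x′)

  decode-onto : ∀ k (l : Word) → 1 ≤ length l → length l ≤ suc k → ∃ λ x → decode k x ≡ l
  decode-onto zero    l 1≤l l≤1 = digits-onto l (≤-antisym l≤1 1≤l)
  decode-onto (suc k) l 1≤l l≤2+k with length l ≤? suc k
  ... | yes l≤1+k = let x , dx = decode-onto k l 1≤l l≤1+k in
    x ↑ˡ _ , trans (cong Sum.[ decode k , digits _ ]′ (splitAt-↑ˡ _ x _)) dx
  ... | no  l≰1+k = let x , dx = digits-onto l (≤-antisym l≤2+k (≰⇒> l≰1+k)) in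
    treeSize k ↑ʳ x , trans (cong Sum.[ decode k , digits _ ]′ (splitAt-↑ʳ _ _ x)) dx

  properPrefix? : (l m : Word) → Dec (l ≼ m × length l < length m)
  properPrefix? l m = prefix? _≟_ l m ×-dec length l <? length m

  properlyComparable : Word → Word → Bool
  properlyComparable l m = does (properPrefix? l m) ∨ does (properPrefix? m l)

  properlyComparable⁻ : {l m : Word} → properlyComparable l m ≡ true → Comparable l m
  properlyComparable⁻ {l} {m} h =
    Sum.map (proj₁ ∘ does-true⁻ (properPrefix? l m)) (proj₁ ∘ does-true⁻ (properPrefix? m l))
            (∨-true⁻ (does (properPrefix? l m)) _ h)

  not-properPrefix-self : (l : Word) → does (properPrefix? l l) ≡ false
  not-properPrefix-self l = dec-false (properPrefix? l l) λ (_ , l<l) → <-irrefl refl l<l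

  module _ (k : ℕ) where

    tree : Graph (treeSize k)
    tree = record
      { adj    = λ u v → properlyComparable (decode k u) (decode k v)
      ; sym    = λ u v → ∨-comm (does (properPrefix? (decode k u) (decode k v)))
                                (does (properPrefix? (decode k v) (decode k u)))
      ; irrefl = λ v → cong₂ _∨_ (not-properPrefix-self (decode k v)) (not-properPrefix-self (decode k v))
      }

    closedNbhd-tree⁻ : {u v : Fin (treeSize k)} → closedNbhd tree u v ≡ true →
                       Comparable (decode k u) (decode k v)
    closedNbhd-tree⁻ {u} {v} u∼v with closedNbhd⁻ tree {u} {v} u∼v
    ... | inj₁ refl = inj₁ ≼-refl
    ... | inj₂ adj  = properlyComparable⁻ adj

    prefix⇒closedNbhd : {u v : Fin (treeSize k)} → decode k u ≼ decode k v → closedNbhd tree u v ≡ true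
    prefix⇒closedNbhd {u} {v} u≼v with length (decode k u) <? length (decode k v)
    ... | yes u<v = closedNbhd-adj tree (cong (_∨ does (properPrefix? (decode k v) (decode k u)))
                                                     (dec-true (properPrefix? _ _) (u≼v , u<v)))
    ... | no  u≮v = subst (λ v → closedNbhd tree u v ≡ true)
                          (decode-injective k (≼-antisym-length u≼v (≮⇒≥ u≮v))) (closedNbhd-self tree u)

    closedNbhd-tree⁺ : {u v : Fin (treeSize k)} → Comparable (decode k u) (decode k v) →
                       closedNbhd tree u v ≡ true
    closedNbhd-tree⁺ (inj₁ u≼v) = prefix⇒closedNbhd u≼v
    closedNbhd-tree⁺ {u} {v} (inj₂ v≼u) = trans (closedNbhd-sym tree u v) (prefix⇒closedNbhd v≼u)

    leaf-nbhd : {v u : Fin (treeSize k)} → length (decode k v) ≡ suc k →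
                closedNbhd tree v u ≡ true → decode k u ≼ decode k v
    leaf-nbhd {v} {u} leaf v∼u with closedNbhd-tree⁻ v∼u
    ... | inj₂ u≼v = u≼v
    ... | inj₁ v≼u = subst (decode k u ≼_) (sym (≼-antisym-length v≼u u≤v)) ≼-refl
      where
      u≤v : length (decode k u) ≤ length (decode k v)
      u≤v = ≤-trans (proj₂ (length-decode k u)) (≤-reflexive (sym leaf))

    vertex : (l : Word) {j : ℕ} → length l ≡ suc j → j ≤ k → ∃ λ v → decode k v ≡ l
    vertex l l≡1+j j≤k =
      decode-onto k l (subst (1 ≤_) (sym l≡1+j) (s≤s z≤n)) (subst (_≤ suc k) (sym l≡1+j) (s≤s j≤k))

    leaf-above : (w : Word) → length w ≤ suc k → ∃ λ v → w ≼ decode k v × length (decode k v) ≡ suc k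
    leaf-above w w≤1+k = let v , dv = vertex L |L| ≤-refl in
      v , subst (w ≼_) (sym dv) (≼-++ w _) , trans (cong length dv) |L|
      where
      L : Word
      L = w ++ replicate (suc k ∸ length w) zero
      |L| : length L ≡ suc k
      |L| = trans (length-++ w) (trans (cong (length w +_) (length-replicate _)) (m+[n∸m]≡n w≤1+k))

    k≤degree : ∀ u → k ≤ degree tree u
    k≤degree u = s≤s⁻¹ (begin
      suc k                                ≤⟨ injection⇒≤∣S∣ _ g g-injective g∈N[u] ⟩
      ∣ tabulate (closedNbhd tree u) ∣     ≡⟨ countTrue≡∣tabulate∣ (closedNbhd tree u) ⟨
      countTrue (closedNbhd tree u)        ≡⟨ countTrue-closedNbhd tree u ⟩
      suc (degree tree u)                  ∎)
      where
      open ≤-Reasoning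
      leaf : ∃ λ v → decode k u ≼ decode k v × length (decode k v) ≡ suc k
      leaf = leaf-above (decode k u) (proj₂ (length-decode k u))
      L : Word
      L = decode k (proj₁ leaf)
      length-prefix : (i : Fin (suc k)) → length (take (suc (toℕ i)) L) ≡ suc (toℕ i)
      length-prefix i = trans (length-take _ L) (trans (cong (suc (toℕ i) ⊓_) (proj₂ (proj₂ leaf)))
                                                       (m≤n⇒m⊓n≡m (toℕ<n i)))
      prefix : (i : Fin (suc k)) → ∃ λ x → decode k x ≡ take (suc (toℕ i)) L
      prefix i = vertex _ (length-prefix i) (s≤s⁻¹ (toℕ<n i))
      g : Fin (suc k) → Fin (treeSize k)
      g = proj₁ ∘ prefix
      g-injective : ∀ {i j} → g i ≡ g j → i ≡ j
      g-injective {i} {j} gi≡gj = toℕ-injective (suc-injective (begin-equality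
        suc (toℕ i)                        ≡⟨ length-prefix i ⟨
        length (take (suc (toℕ i)) L)      ≡⟨ cong length prefix-i≡prefix-j ⟩
        length (take (suc (toℕ j)) L)      ≡⟨ length-prefix j ⟩
        suc (toℕ j)                        ∎))
        where
        prefix-i≡prefix-j : take (suc (toℕ i)) L ≡ take (suc (toℕ j)) L
        prefix-i≡prefix-j = trans (sym (proj₂ (prefix i))) (trans (cong (decode k) gi≡gj) (proj₂ (prefix j)))
      g∈N[u] : ∀ i → g i ∈ tabulate (closedNbhd tree u)
      g∈N[u] i = ∈-tabulate _ (closedNbhd-tree⁺
        (≼-total-below (proj₁ (proj₂ leaf)) (subst (_≼ L) (sym (proj₂ (prefix i))) (take-≼ _ L))))

    PathOwned : Position (treeSize k) → Word → Set
    PathOwned p w = ∀ u → decode k u ≼ w → p u ≡ stal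

    FreeFrom : Position (treeSize k) → Word → Set
    FreeFrom p x = ∀ u → x ≼ decode k u → p u ≡ free

    StallerAt : Position (treeSize k) → Word → Set
    StallerAt p w = PathOwned p w × (∀ c → FreeFrom p (w ∷ʳ c))

    -- Every leaf below w ∷ʳ c has a closed neighbourhood without Dominator vertices.
    undominated-below : {p : Position (treeSize k)} {w : Word} {c : Fin B} → length w ≤ k →
                        PathOwned p w → FreeFrom p (w ∷ʳ c) → ¬ DomHasDominating tree p
    undominated-below {p} {w} {c} w≤k owned below dominating
      with leaf-above (w ∷ʳ c) (≤-trans (≤-reflexive (length-∷ʳ w c)) (s≤s w≤k))
    ... | v , wc≼v , leaf with dominating⇒dominated tree dominating v
    ...   | u , v∼u , pu with ≼-total-below (leaf-nbhd leaf v∼u) wc≼v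
    ...     | inj₂ wc≼u = contradiction (trans (sym (below u wc≼u)) pu) λ ()
    ...     | inj₁ u≼wc with ≼-∷ʳ⁻ u≼wc
    ...       | inj₁ u≼w  = contradiction (trans (sym (owned u u≼w)) pu) λ ()
    ...       | inj₂ u≡wc =
      contradiction (trans (sym (below u (subst (_≼ decode k u) u≡wc ≼-refl))) pu) λ ()

    pathToLeaf⇒StWinsD : ∀ {b p L} → length L ≡ suc k → PathOwned p L → StWinsD tree b p
    pathToLeaf⇒StWinsD {b} {p} {L} leaf owned with vertex L leaf ≤-refl
    ... | v , dv = ownsNbhd⇒StWinsD tree b (freeCount p) {v = v} ≤-refl λ u v∼u →
      owned u (subst (decode k u ≼_) dv (leaf-nbhd (trans (cong length dv) leaf) v∼u))

    module _ {b : ℕ} (b≤a : b ≤ a) where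

      untouchedChild : {p : Position (treeSize k)} {S : Subset (treeSize k)} → LegalDomMove b p S →
                       (w : Word) → ∃ λ c → ∀ u → u ∈ S → ¬ (w ∷ʳ c ≼ decode k u)
      untouchedChild {S = S} (_ , ∣S∣≤b , _) w =
        pigeonhole S (λ c u → w ∷ʳ c ≼ decode k u) (λ c u → prefix? _≟_ (w ∷ʳ c) (decode k u))
                   ∷ʳ-≼-injective (s≤s (≤-trans ∣S∣≤b b≤a))

      stallerReply : {q : Position (treeSize k)} {w : Word} {c : Fin B} → length w ≤ k →
                     PathOwned q w → FreeFrom q (w ∷ʳ c) →
                     (∀ {p′} → StallerAt p′ (w ∷ʳ c) → StWinsD tree b p′) → StWinsS tree b q
      stallerReply {q} {w} {c} w≤k owned below continue =
        step (undominated-below w≤k owned below) v qv (continue (owned′ , below′))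
        where
        child : ∃ λ v → decode k v ≡ w ∷ʳ c
        child = vertex (w ∷ʳ c) (length-∷ʳ w c) w≤k
        v : Fin (treeSize k)
        v = proj₁ child
        dv : decode k v ≡ w ∷ʳ c
        dv = proj₂ child
        qv : q v ≡ free
        qv = below v (subst (w ∷ʳ c ≼_) (sym dv) ≼-refl)
        owned′ : PathOwned (claimVertex q v) (w ∷ʳ c)
        owned′ u u≼wc with ≼-∷ʳ⁻ u≼wc
        ... | inj₁ u≼w  = claimVertex-stal q {v} (owned u u≼w)
        ... | inj₂ u≡wc = subst (λ x → claimVertex q v x ≡ stal) (decode-injective k (trans dv (sym u≡wc)))
                                (claimVertex-self q v)
        below′ : ∀ c′ → FreeFrom (claimVertex q v) ((w ∷ʳ c) ∷ʳ c′)
        below′ c′ u wcc′≼u = trans (claimVertex-other q v≢u) (below u (∷ʳ-≼⁻ wcc′≼u))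
          where
          v≢u : v ≢ u
          v≢u refl = <-irrefl refl (begin-strict
            length (decode k v)           ≡⟨ cong length dv ⟩
            length (w ∷ʳ c)               <⟨ n<1+n _ ⟩
            suc (length (w ∷ʳ c))         ≡⟨ length-∷ʳ (w ∷ʳ c) c′ ⟨
            length ((w ∷ʳ c) ∷ʳ c′)       ≤⟨ length-mono wcc′≼u ⟩
            length (decode k v)           ∎)
            where open ≤-Reasoning

      stallerRound : {p : Position (treeSize k)} {w : Word} → length w ≤ k → StallerAt p w →
                     (∀ {c p′} → StallerAt p′ (w ∷ʳ c) → StWinsD tree b p′) → StWinsD tree b p
      stallerRound {p} {w} w≤k (owned , below) continue =
        step (undominated-below w≤k owned (below zero)) λ S legal →
          let c , untouched = untouchedChild legal w in
          stallerReply w≤k (λ u → claimSet-stal legal ∘ owned u)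
                           (λ u wc≼u → trans (claimSet-∉ p λ u∈S → untouched u u∈S wc≼u) (below c u wc≼u))
                           continue

      stallerWinsFrom : ∀ r {p w} → length w + r ≡ k → StallerAt p w → StWinsD tree b p
      stallerWinsFrom zero {w = w} w≡k inv =
        stallerRound (≤-reflexive (trans (sym (+-identityʳ _)) w≡k)) inv λ {c} (owned , _) →
          pathToLeaf⇒StWinsD (trans (length-∷ʳ w c) (cong suc (trans (sym (+-identityʳ _)) w≡k))) owned
      stallerWinsFrom (suc r) {w = w} w+1+r≡k inv =
        stallerRound (≤-trans (m≤m+n _ _) (≤-reflexive w+1+r≡k)) inv λ {c} inv′ →
          stallerWinsFrom r (trans (cong (_+ r) (length-∷ʳ w c)) (trans (sym (+-suc _ r)) w+1+r≡k)) inv′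

      stallerWins : StallerWins tree b
      stallerWins = stallerWinsFrom k refl (no-root , λ _ _ _ → refl)
        where
        no-root : PathOwned start []
        no-root u u≼[] = contradiction (length-mono u≼[]) (<⇒≱ (proj₁ (length-decode k u)))

  1+k≤treeSize : ∀ k → suc k ≤ treeSize k
  1+k≤treeSize zero    = s≤s z≤n
  1+k≤treeSize (suc k) =
    ≤-trans (≤-reflexive (+-comm 1 (suc k))) (+-mono-≤ (1+k≤treeSize k) (m^n>0 B (suc (suc k))))

  treeSize<B^[2+k] : 1 ≤ a → ∀ k → treeSize k < B ^ suc (suc k)
  treeSize<B^[2+k] 1≤a zero    = ^-monoʳ-< B (s≤s 1≤a) (n<1+n 1)
  treeSize<B^[2+k] 1≤a (suc k) = begin-strict
    treeSize k + X  <⟨ +-monoˡ-< X (treeSize<B^[2+k] 1≤a k) ⟩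
    X + X           ≤⟨ +-monoʳ-≤ X (≤-trans (≤-reflexive (sym (*-identityˡ X))) (*-monoˡ-≤ X 1≤a)) ⟩
    B * X           ∎
    where
    open ≤-Reasoning
    X : ℕ
    X = B ^ suc (suc k)

  tree-minDeg : 1 ≤ a → ∀ k → MinDegAboveLogMinus (tree k) a 2
  tree-minDeg 1≤a k v = <-≤-trans (treeSize<B^[2+k] 1≤a k)
    (^-monoʳ-≤ B (≤-trans (≤-reflexive (+-comm 2 k)) (+-monoˡ-≤ 2 (k≤degree k v))))

theorem1p8 : (b : ℕ) → 1 ≤ b →
    ((n : ℕ) → 1 ≤ n → (G : Graph n) → MinDegAboveLogMinus G b 1 → DominatorWins G b)
    × ((m : ℕ) → Σ ℕ λ n → m ≤ n × 1 ≤ n ×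
        Σ (Graph n) λ G → MinDegAboveLogMinus G b 2 × StallerWins G b)
theorem1p8 b 1≤b =
    (λ _ _ G → Potential.dominatorWins G b 1≤b)
  , λ m → treeSize m , ≤-trans (n≤1+n m) (1+k≤treeSize m) , ≤-trans (s≤s z≤n) (1+k≤treeSize m)
        , tree m , tree-minDeg 1≤b m , stallerWins m ≤-refl
  where open PrefixTree b
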